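{- Let $L(0,n-1)$ be a path with thresholds $t(0)=t(n-1)=1$, $t(i)\in\{1,2\}$ otherwise, let $\lambda\ge 2$, and let $L(j,k)$ be a subpath. For all integers $1\le \ell<\ell'\le\lambda$: (1) if $t(k)=1$ then $OPT(j,k,\leftarrow)\le OPT(j,k)\le OPT(j,k,\overset{\ell}{\rightarrow})\le OPT(j,k,\overset{\ell'}{\rightarrow})\le OPT(j,k,\leftarrow)+1$; (2) if $t(j)=1$ then $OPT(\rightarrow,j,k)\le OPT(j,k)\le OPT(\overset{\ell}{\leftarrow},j,k)\le OPT(\overset{\ell'}{\leftarrow},j,k)\le OPT(\rightarrow,j,k)+1$.
   Context: $L(0,n-1)$ denotes the path with nodes $0,\dots,n-1$ and edges $\{i,i+1\}$; for $0\le j\le k\le n-1$, $L(j,k)$ is the subpath induced by $j,\dots,k$, each node keeping its threshold $t(i)$. Incentives are functions $p$ with $0\le p(i)\le t(i)$; the influence process on a graph with thresholds $t$ and incentives $p$ is $\mathsf{Influenced}[p,0]=\{v:p(v)=t(v)\}$, $\mathsf{Influenced}[p,\ell]=\mathsf{Influenced}[p,\ell-1]\cup\{v:|N(v)\cap\mathsf{Influenced}[p,\ell-1]|\ge t(v)-p(v)\}$. The TBI problem on a graph asks for incentives of minimum total cost $\sum p(v)$ such that all nodes are in $\mathsf{Influenced}[p,\lambda]$. For the subpath $L(j,k)$ (influence process run on $L(j,k)$ alone): (i) $OPT(j,k)$ is the optimal TBI cost on $L(j,k)$; (ii) $OPT(j,k,\leftarrow)$ is the optimal TBI cost on $L(j,k)$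 under the additional condition that node $k$ gets one unit of influence from the outside node $k+1$ (i.e., the threshold of $k$ is effectively reduced by one); (iii) $OPT(j,k,\overset{\ell}{\rightarrow})$ is the optimal TBI cost on $L(j,k)$ under the additional condition that node $k$ is influenced by round $\lambda-\ell$ without getting influence from node $k+1$; (iv) $OPT(\rightarrow,j,k)$ is the optimal TBI cost on $L(j,k)$ under the additional condition that node $j$ gets one unit of influence from the outside node $j-1$; (v) $OPT(\overset{\ell}{\leftarrow},j,k)$ is the optimal TBI cost on $L(j,k)$ under the additional condition that node $j$ is influenced by round $\lambda-\ell$ without getting influence from node $j-1$. -}

module Defs where

open import Data.Nat using (ℕ; zero; suc; _+_; _∸_; _≤_; _≡ᵇ_; _≤ᵇ_; _<ᵇ_)
open import Data.Bool using (Bool; true; false; _∨_; _∧_; if_then_else_)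
open import Data.Product using (Σ; _×_; _,_)
open import Relation.Binary.PropositionalEquality using (_≡_)

-- Nodes of the path are natural numbers; thresholds and incentives are
-- functions ℕ → ℕ (only their values on the relevant interval matter).
Thresholds : Set
Thresholds = ℕ → ℕ

Incentive : Set
Incentive = ℕ → ℕ

-- Influence process run on the subpath L(j,k) alone (node v has neighbours
-- v-1 if j < v and v+1 if v < k).
-- influenced t p j k r v = true  iff  v ∈ Influenced[p, r]  on L(j,k).
influenced : Thresholds → Incentive → ℕ → ℕ → ℕ → ℕ → Bool
influenced t p j k zero v = p v ≡ᵇ t v
influenced t p j k (suc r) v =
  influenced t p j k r v ∨ ((t v ∸ p v) ≤ᵇ (left + right))
  where
  left : ℕ
  left = if (j <ᵇ v) ∧ influenced t p j k r (v ∸ 1) then 1 else 0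
  right : ℕ
  right = if (v <ᵇ k) ∧ influenced t p j k r (suc v) then 1 else 0

ValidIncentive : Thresholds → ℕ → ℕ → Incentive → Set
ValidIncentive t j k p = ∀ v → j ≤ v → v ≤ k → p v ≤ t v

AllInfluenced : Thresholds → ℕ → ℕ → ℕ → Incentive → Set
AllInfluenced t j k λ' p = ∀ v → j ≤ v → v ≤ k → influenced t p j k λ' v ≡ true

TBIFeasible : Thresholds → ℕ → ℕ → ℕ → Incentive → Set
TBIFeasible t j k λ' p = ValidIncentive t j k p × AllInfluenced t j k λ' p

sumFrom : ℕ → ℕ → Incentive → ℕ
sumFrom j zero p = 0
sumFrom j (suc m) p = p j + sumFrom (suc j) m p

cost : ℕ → ℕ → Incentive → ℕ
cost j k p = sumFrom j (suc k ∸ j) p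

IsMinCost : ℕ → ℕ → (Incentive → Set) → ℕ → Set
IsMinCost j k S c = Σ Incentive (λ p → S p × cost j k p ≡ c)
                  × (∀ p → S p → c ≤ cost j k p)

-- Reduce the threshold of node u by one (one unit of outside influence).
reduceAt : ℕ → Thresholds → Thresholds
reduceAt u t v = if v ≡ᵇ u then t v ∸ 1 else t v

IsOPT : Thresholds → ℕ → ℕ → ℕ → ℕ → Set
IsOPT t λ' j k = IsMinCost j k (TBIFeasible t j k λ')

-- c = OPT(j,k,←)  : node k gets one unit of influence from k+1
IsOPT← : Thresholds → ℕ → ℕ → ℕ → ℕ → Set
IsOPT← t λ' j k = IsMinCost j k (TBIFeasible (reduceAt k t) j k λ')

-- c = OPT(j,k,ℓ→) : node k influenced by round λ-ℓ (process on L(j,k) alone)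
IsOPT→ : Thresholds → ℕ → ℕ → ℕ → ℕ → ℕ → Set
IsOPT→ t λ' ℓ j k = IsMinCost j k
  (λ p → TBIFeasible t j k λ' p × influenced t p j k (λ' ∸ ℓ) k ≡ true)

-- c = OPT(→,j,k)  : node j gets one unit of influence from j-1
IsOPT→' : Thresholds → ℕ → ℕ → ℕ → ℕ → Set
IsOPT→' t λ' j k = IsMinCost j k (TBIFeasible (reduceAt j t) j k λ')

-- c = OPT(ℓ←,j,k) : node j influenced by round λ-ℓ (process on L(j,k) alone)
IsOPT←' : Thresholds → ℕ → ℕ → ℕ → ℕ → ℕ → Set
IsOPT←' t λ' ℓ j k = IsMinCost j k
  (λ p → TBIFeasible t j k λ' p × influenced t p j k (λ' ∸ ℓ) j ≡ true)

-- The four optima are compared by transforming optimal incentives.  Dropping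
-- the incentive on the threshold-one end node u turns a plain solution into
-- one with outside help (a ≤ b); paying one unit at u instead of taking the
-- outside help makes u a seed, influenced at every round (d ≤ a + 1); the
-- middle inequalities are inclusions of the constraint sets.  Influence is
-- monotone in the deficits t(v) − p(v), which carries feasibility across both
-- transformations.  The optima exist because feasibility only depends on the
-- incentive on the path and incentives are bounded by the thresholds, so a
-- minimum can be taken over finitely many candidates.
module Submission where

open import Defs
open import Algebra.Properties.CommutativeSemigroup using (x∙yz≈y∙xz)
open import Data.Bool using (Bool; true; false; T; _∨_; _∧_; if_then_else_)
open import Data.Bool.Properties using (T-≡; ∨-zeroʳ) renaming (_≟_ to _≟ᵇ_)
open import Data.Empty using (⊥-elim)
open import Data.List using (List; []; _∷_; upTo; filter; cartesianProductWith)
open import Data.List.Membership.Propositional using (_∈_)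
open import Data.List.Membership.Propositional.Properties
  using (∈-filter⁺; ∈-upTo⁺; ∈-cartesianProductWith⁺)
open import Data.List.Relation.Unary.All using (lookup)
open import Data.List.Relation.Unary.All.Properties using (all-filter)
open import Data.List.Relation.Unary.Any using (here)
open import Data.Nat
  using (ℕ; zero; suc; _+_; _∸_; _≤_; _<_; _≤′_; ≤′-refl; ≤′-step;
         _≡ᵇ_; _<ᵇ_; z≤n; s≤s; _≤?_)
open import Data.Nat.Properties
open import Data.List.Extrema ≤-totalOrder using (argmin; argmin-all; f[argmin]≤f[xs])
open import Data.Product using (Σ; ∃; _×_; _,_; proj₁)
open import Data.Sum using (_⊎_; inj₁; inj₂; [_,_]′)
open import Function.Bundles using (Equivalence)
open import Relation.Nullary using (Dec; yes; no)
open import Relation.Nullary.Decidable using (_×-dec_; _→-dec_; map′)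
open import Relation.Unary using (Decidable)
open import Relation.Binary.PropositionalEquality

≡true⇒T : ∀ {b} → b ≡ true → T b
≡true⇒T = Equivalence.from T-≡

T⇒≡true : ∀ {b} → T b → b ≡ true
T⇒≡true = Equivalence.to T-≡

∨-introˡ : ∀ {x y} → x ≡ true → x ∨ y ≡ true
∨-introˡ refl = refl

∨-introʳ : ∀ {x y} → y ≡ true → x ∨ y ≡ true
∨-introʳ {x} refl = ∨-zeroʳ x

∨-elim : ∀ {x y} → x ∨ y ≡ true → x ≡ true ⊎ y ≡ true
∨-elim {true} _ = inj₁ refl
∨-elim {false} y≡true = inj₂ y≡true

∧-monoʳ : ∀ {a x y} → (a ≡ true → x ≡ true → y ≡ true) → a ∧ x ≡ true → a ∧ y ≡ true
∧-monoʳ {true} x⇒y x≡true = x⇒y refl x≡true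

indicator-mono : ∀ {a b : Bool} → (a ≡ true → b ≡ true) →
                 (if a then 1 else 0) ≤ (if b then 1 else 0)
indicator-mono {false} _ = z≤n
indicator-mono {true} a⇒b rewrite a⇒b refl = ≤-refl

OnPath : ℕ → ℕ → (ℕ → Set) → Set
OnPath j k P = ∀ v → j ≤ v → v ≤ k → P v

record OnRange (j m : ℕ) (P : ℕ → Set) : Set where
  constructor onRange
  field holds : ∀ v → j ≤ v → v < j + m → P v

module _ {P : ℕ → Set} where

  OnRange-empty : ∀ {j} → OnRange j 0 P
  OnRange-empty {j} = onRange λ v j≤v v<j+0 →
    ⊥-elim (<⇒≱ (subst (v <_) (+-identityʳ j) v<j+0) j≤v)

  OnRange-head : ∀ {j m} → OnRange j (suc m) P → P j
  OnRange-head {j} (onRange all) = all j ≤-refl (m<m+n j (s≤s z≤n))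

  OnRange-tail : ∀ {j m} → OnRange j (suc m) P → OnRange (suc j) m P
  OnRange-tail {j} {m} (onRange all) = onRange λ v j<v v<1+j+m →
    all v (<⇒≤ j<v) (subst (v <_) (sym (+-suc j m)) v<1+j+m)

  OnRange-cons : ∀ {j m} → P j → OnRange (suc j) m P → OnRange j (suc m) P
  OnRange-cons {j} {m} Pj (onRange all) = onRange at
    where
    at : ∀ v → j ≤ v → v < j + suc m → P v
    at v j≤v v<j+1+m with m≤n⇒m<n∨m≡n j≤v
    ... | inj₁ j<v = all v j<v (subst (v <_) (+-suc j m) v<j+1+m)
    ... | inj₂ refl = Pj

  OnPath⇒OnRange : ∀ {j k} → j ≤ k → OnPath j k P → OnRange j (suc k ∸ j) P
  OnPath⇒OnRange j≤k all = onRange λ v j≤v v<end →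
    all v j≤v (<⇒≤pred (subst (v <_) (m+[n∸m]≡n (m≤n⇒m≤1+n j≤k)) v<end))

  OnRange⇒OnPath : ∀ {j k} → j ≤ k → OnRange j (suc k ∸ j) P → OnPath j k P
  OnRange⇒OnPath j≤k (onRange all) v j≤v v≤k =
    all v j≤v (subst (v <_) (sym (m+[n∸m]≡n (m≤n⇒m≤1+n j≤k))) (s≤s v≤k))

onPath? : ∀ {P : ℕ → Set} → Decidable P → ∀ j k → Dec (OnPath j k P)
onPath? P? j k = map′
  (λ all v j≤v v≤k → all (s≤s v≤k) j≤v)
  (λ all {v} v<1+k j≤v → all v j≤v (<⇒≤pred v<1+k))
  (allUpTo? (λ v → (j ≤? v) →-dec P? v) (suc k))

_[_≔_] : Incentive → ℕ → ℕ → Incentive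
(p [ u ≔ x ]) v = if v ≡ᵇ u then x else p v

update-same : ∀ {p : Incentive} {u x} → (p [ u ≔ x ]) u ≡ x
update-same {u = u} rewrite T⇒≡true (≡⇒≡ᵇ u u refl) = refl

update-other : ∀ {p : Incentive} {u x v} → v ≢ u → (p [ u ≔ x ]) v ≡ p v
update-other {u = u} {v = v} v≢u with v ≡ᵇ u in v≡u
... | true = ⊥-elim (v≢u (≡ᵇ⇒≡ v u (≡true⇒T v≡u)))
... | false = refl

reduceAt-≤ : ∀ u t v → reduceAt u t v ≤ t v
reduceAt-≤ u t v with v ≡ᵇ u
... | true = m∸n≤m (t v) 1
... | false = ≤-refl

sumFrom-cong : ∀ {p q : Incentive} j m → OnRange j m (λ v → p v ≡ q v) →
               sumFrom j m p ≡ sumFrom j m q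
sumFrom-cong j zero _ = refl
sumFrom-cong j (suc m) p≗q =
  cong₂ _+_ (OnRange-head p≗q) (sumFrom-cong (suc j) m (OnRange-tail p≗q))

sumFrom-update : ∀ p u x j m → sumFrom j m (p [ u ≔ x ]) ≤ x + sumFrom j m p
sumFrom-update p u x j zero = z≤n
sumFrom-update p u x j (suc m) with j ≟ u
... | yes refl rewrite update-same {p} {j} {x}
                     | sumFrom-cong (suc j) m
                         (onRange λ v j<v _ → update-other {p} {j} {x} (>⇒≢ j<v)) =
  +-monoʳ-≤ x (m≤n+m (sumFrom (suc j) m p) (p j))
... | no j≢u rewrite update-other {p} {u} {x} j≢u =
  ≤-trans (+-monoʳ-≤ (p j) (sumFrom-update p u x (suc j) m))
          (≤-reflexive (x∙yz≈y∙xz +-commutativeSemigroup (p j) x (sumFrom (suc j) m p)))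

candidates : ℕ → ℕ → ℕ → List Incentive
candidates B j zero = (λ _ → 0) ∷ []
candidates B j (suc m) =
  cartesianProductWith (λ x q → q [ j ≔ x ]) (upTo (suc B)) (candidates B (suc j) m)

candidates-cover : ∀ B j m {p : Incentive} → OnRange j m (λ v → p v ≤ B) →
                   ∃ λ q → q ∈ candidates B j m × OnRange j m (λ v → p v ≡ q v)
candidates-cover B j zero _ = _ , here refl , OnRange-empty
candidates-cover B j (suc m) {p} p≤B with candidates-cover B (suc j) m (OnRange-tail p≤B)
... | q , q∈ , p≗q =
  q [ j ≔ p j ]
  , ∈-cartesianProductWith⁺ (λ x q → q [ j ≔ x ]) (∈-upTo⁺ (s≤s (OnRange-head p≤B))) q∈
  , OnRange-cons (sym (update-same {q}))
      (onRange λ v j<v v<end → trans (OnRange.holds p≗q v j<v v<end)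
                                     (sym (update-other {q} (>⇒≢ j<v))))

module _ {A : Set} (f : A → ℕ) {S : A → Set} (S? : Decidable S) where

  minimiser-exists : (cs : List A) →
                     (∀ {p} → S p → ∃ λ q → q ∈ cs × S q × f q ≤ f p) →
                     ∀ {p₀} → S p₀ → ∃ λ q → S q × (∀ p → S p → f q ≤ f p)
  minimiser-exists cs cover {p₀} Sp₀ =
    argmin f p₀ (filter S? cs) , argmin-all f Sp₀ (all-filter S? cs) , minimal
    where
    minimal : ∀ p → S p → f (argmin f p₀ (filter S? cs)) ≤ f p
    minimal p Sp with cover Sp
    ... | q , q∈ , Sq , fq≤fp =
      ≤-trans (lookup (f[argmin]≤f[xs] p₀ (filter S? cs)) (∈-filter⁺ S? q∈ Sq)) fq≤fp

minCost-exists : ∀ {j k} {S : Incentive → Set} → j ≤ k → Decidable S →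
                 (∀ {p q : Incentive} → OnPath j k (λ v → p v ≡ q v) → S p → S q) →
                 (B : ℕ) → (∀ {p : Incentive} → S p → OnPath j k (λ v → p v ≤ B)) →
                 ∀ {p₀} → S p₀ → Σ ℕ (IsMinCost j k S)
minCost-exists {j} {k} {S} j≤k S? S-cong B S-bounded Sp₀ =
  let q , Sq , minimal = minimiser-exists (cost j k) S? (candidates B j (suc k ∸ j)) cover Sp₀
  in cost j k q , (q , Sq , refl) , minimal
  where
  cover : ∀ {p} → S p → ∃ λ q → q ∈ candidates B j (suc k ∸ j) × S q × cost j k q ≤ cost j k p
  cover Sp with candidates-cover B j (suc k ∸ j) (OnPath⇒OnRange j≤k (S-bounded Sp))
  ... | q , q∈ , p≗q = q , q∈ , S-cong (OnRange⇒OnPath j≤k p≗q) Sp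
                     , ≤-reflexive (sym (sumFrom-cong j (suc k ∸ j) p≗q))

minCost-≤ : ∀ {j k} {S₁ S₂ : Incentive → Set} {a b} e →
            IsMinCost j k S₁ a → IsMinCost j k S₂ b →
            (∀ {p} → S₂ p → ∃ λ q → S₁ q × cost j k q ≤ e + cost j k p) → a ≤ e + b
minCost-≤ e (_ , a-minimal) ((p , S₂p , refl) , _) transfer with transfer S₂p
... | q , S₁q , q≤p = ≤-trans (a-minimal q S₁q) q≤p

minCost-⊆ : ∀ {j k} {S₁ S₂ : Incentive → Set} {a b} →
            IsMinCost j k S₁ a → IsMinCost j k S₂ b → (∀ {p} → S₂ p → S₁ p) → a ≤ b
minCost-⊆ {j} {k} A B S₂⊆S₁ = minCost-≤ {j} {k} 0 A B (λ S₂p → _ , S₂⊆S₁ S₂p , ≤-refl)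

module _ {t₁ t₂ : Thresholds} {p₁ p₂ : Incentive} {j k : ℕ}
  (deficit≤ : OnPath j k (λ v → t₂ v ∸ p₂ v ≤ t₁ v ∸ p₁ v))
  (seed⇒seed : OnPath j k (λ v → (p₁ v ≡ᵇ t₁ v) ≡ true → (p₂ v ≡ᵇ t₂ v) ≡ true)) where

  influenced-mono : ∀ r → OnPath j k (λ v → influenced t₁ p₁ j k r v ≡ true →
                                            influenced t₂ p₂ j k r v ≡ true)
  influenced-mono zero = seed⇒seed
  influenced-mono (suc r) v j≤v v≤k inf with ∨-elim inf
  ... | inj₁ earlier = ∨-introˡ (influenced-mono r v j≤v v≤k earlier)
  ... | inj₂ enough = ∨-introʳ (T⇒≡true (≤⇒≤ᵇ
        (≤-trans (deficit≤ v j≤v v≤k)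
        (≤-trans (≤ᵇ⇒≤ _ _ (≡true⇒T enough))
                 (+-mono-≤ (indicator-mono (∧-monoʳ left)) (indicator-mono (∧-monoʳ right)))))))
    where
    left : (j <ᵇ v) ≡ true → influenced t₁ p₁ j k r (v ∸ 1) ≡ true →
           influenced t₂ p₂ j k r (v ∸ 1) ≡ true
    left j<v = influenced-mono r (v ∸ 1) (<⇒≤pred (<ᵇ⇒< j v (≡true⇒T j<v)))
                                         (≤-trans (m∸n≤m v 1) v≤k)
    right : (v <ᵇ k) ≡ true → influenced t₁ p₁ j k r (suc v) ≡ true →
            influenced t₂ p₂ j k r (suc v) ≡ true
    right v<k = influenced-mono r (suc v) (m≤n⇒m≤1+n j≤v) (<ᵇ⇒< v k (≡true⇒T v<k))

influenced-rounds-mono : ∀ {t : Thresholds} {p : Incentive} {j k r r' v} → r ≤ r' →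
                         influenced t p j k r v ≡ true → influenced t p j k r' v ≡ true
influenced-rounds-mono {t} {p} {j} {k} {r} {v = v} r≤r' = later (≤⇒≤′ r≤r')
  where
  later : ∀ {r'} → r ≤′ r' → influenced t p j k r v ≡ true → influenced t p j k r' v ≡ true
  later ≤′-refl inf = inf
  later (≤′-step r≤′r') inf = ∨-introˡ (later r≤′r' inf)

seed-influenced : ∀ {t : Thresholds} {p : Incentive} {j k} r {v} →
                  p v ≡ t v → influenced t p j k r v ≡ true
seed-influenced {t} {p} r {v} p≡t =
  influenced-rounds-mono (z≤n {r}) (T⇒≡true (≡⇒≡ᵇ (p v) (t v) p≡t))

influenced-cong : ∀ {t : Thresholds} {p q : Incentive} {j k} → OnPath j k (λ v → p v ≡ q v) →
                  ∀ r → OnPath j k (λ v → influenced t p j k r v ≡ true →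
                                          influenced t q j k r v ≡ true)
influenced-cong {t} p≗q = influenced-mono
  (λ v j≤v v≤k → ≤-reflexive (cong (t v ∸_) (sym (p≗q v j≤v v≤k))))
  (λ v j≤v v≤k → subst (λ x → (x ≡ᵇ t v) ≡ true) (p≗q v j≤v v≤k))

feasible-cong : ∀ {t j k} r {p q : Incentive} → OnPath j k (λ v → p v ≡ q v) →
                TBIFeasible t j k r p → TBIFeasible t j k r q
feasible-cong {t} r p≗q (valid , all-influenced) =
  (λ v j≤v v≤k → subst (_≤ t v) (p≗q v j≤v v≤k) (valid v j≤v v≤k))
  , λ v j≤v v≤k → influenced-cong p≗q r v j≤v v≤k (all-influenced v j≤v v≤k)

feasible? : ∀ t j k r → Decidable (TBIFeasible t j k r)
feasible? t j k r p = onPath? (λ v → p v ≤? t v) j k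
                ×-dec onPath? (λ v → influenced t p j k r v ≟ᵇ true) j k

thresholds-feasible : ∀ {t : Thresholds} {j k} r → TBIFeasible t j k r t
thresholds-feasible r = (λ _ _ _ → ≤-refl) , λ _ _ _ → seed-influenced r refl

module AssistedNode (t : Thresholds) (λ' j k u : ℕ) (j≤u : j ≤ u) (u≤k : u ≤ k)
  (t[u]≡1 : t u ≡ 1) {B : ℕ} (t≤B : OnPath j k (λ v → t v ≤ B)) where

  Feasible Assisted : Incentive → Set
  Feasible = TBIFeasible t j k λ'
  Assisted = TBIFeasible (reduceAt u t) j k λ'

  InfluencedBy : ℕ → Incentive → Set
  InfluencedBy ℓ p = Feasible p × influenced t p j k (λ' ∸ ℓ) u ≡ true

  j≤k : j ≤ k
  j≤k = ≤-trans j≤u u≤k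

  t-at-u : ∀ v → (v ≡ᵇ u) ≡ true → t v ≡ 1
  t-at-u v v≡u = trans (cong t (≡ᵇ⇒≡ v u (≡true⇒T v≡u))) t[u]≡1

  drop-assist : ∀ {p} → Feasible p → Assisted (p [ u ≔ 0 ])
  drop-assist {p} (valid , all-influenced) =
    valid′ , λ v j≤v v≤k →
      influenced-mono deficit≤ seed⇒seed λ' v j≤v v≤k (all-influenced v j≤v v≤k)
    where
    valid′ : ValidIncentive (reduceAt u t) j k (p [ u ≔ 0 ])
    valid′ v j≤v v≤k with v ≡ᵇ u
    ... | true = z≤n
    ... | false = valid v j≤v v≤k
    deficit≤ : OnPath j k (λ v → reduceAt u t v ∸ (p [ u ≔ 0 ]) v ≤ t v ∸ p v)
    deficit≤ v _ _ with v ≡ᵇ u in v≡u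
    ... | true rewrite t-at-u v v≡u = z≤n
    ... | false = ≤-refl
    seed⇒seed : OnPath j k (λ v → (p v ≡ᵇ t v) ≡ true →
                                  ((p [ u ≔ 0 ]) v ≡ᵇ reduceAt u t v) ≡ true)
    seed⇒seed v _ _ seed with v ≡ᵇ u in v≡u
    ... | true rewrite t-at-u v v≡u = refl
    ... | false = seed

  pay-for-assist : ∀ {p} ℓ → Assisted p → InfluencedBy ℓ (p [ u ≔ 1 ])
  pay-for-assist {p} ℓ (valid , all-influenced) =
    ( valid′
    , λ v j≤v v≤k →
        influenced-mono deficit≤ seed⇒seed λ' v j≤v v≤k (all-influenced v j≤v v≤k))
    , seed-influenced (λ' ∸ ℓ) (trans (update-same {p}) (sym t[u]≡1))
    where
    valid′ : ValidIncentive t j k (p [ u ≔ 1 ])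
    valid′ v j≤v v≤k with v ≡ᵇ u in v≡u | valid v j≤v v≤k
    ... | true | _ rewrite t-at-u v v≡u = ≤-refl
    ... | false | p≤t = p≤t
    deficit≤ : OnPath j k (λ v → t v ∸ (p [ u ≔ 1 ]) v ≤ reduceAt u t v ∸ p v)
    deficit≤ v _ _ with v ≡ᵇ u in v≡u
    ... | true rewrite t-at-u v v≡u = z≤n
    ... | false = ≤-refl
    seed⇒seed : OnPath j k (λ v → (p v ≡ᵇ reduceAt u t v) ≡ true →
                                  ((p [ u ≔ 1 ]) v ≡ᵇ t v) ≡ true)
    seed⇒seed v _ _ seed with v ≡ᵇ u in v≡u
    ... | true rewrite t-at-u v v≡u = refl
    ... | false = seed

  InfluencedBy-mono : ∀ {ℓ ℓ' p} → ℓ ≤ ℓ' → InfluencedBy ℓ' p → InfluencedBy ℓ p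
  InfluencedBy-mono ℓ≤ℓ' (feasible , inf) =
    feasible , influenced-rounds-mono (∸-monoʳ-≤ λ' ℓ≤ℓ') inf

  feasible-bounded : ∀ {p} → Feasible p → OnPath j k (λ v → p v ≤ B)
  feasible-bounded (valid , _) v j≤v v≤k = ≤-trans (valid v j≤v v≤k) (t≤B v j≤v v≤k)

  assisted-bounded : ∀ {p} → Assisted p → OnPath j k (λ v → p v ≤ B)
  assisted-bounded (valid , _) v j≤v v≤k =
    ≤-trans (valid v j≤v v≤k) (≤-trans (reduceAt-≤ u t v) (t≤B v j≤v v≤k))

  assisted-optimum : Σ ℕ (IsMinCost j k Assisted)
  assisted-optimum = minCost-exists j≤k (feasible? _ j k λ') (feasible-cong λ') B
                                    assisted-bounded (thresholds-feasible λ')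

  feasible-optimum : Σ ℕ (IsMinCost j k Feasible)
  feasible-optimum = minCost-exists j≤k (feasible? t j k λ') (feasible-cong λ') B
                                    feasible-bounded (thresholds-feasible λ')

  influencedBy-optimum : ∀ ℓ → Σ ℕ (IsMinCost j k (InfluencedBy ℓ))
  influencedBy-optimum ℓ = minCost-exists j≤k
    (λ p → feasible? t j k λ' p ×-dec (influenced t p j k (λ' ∸ ℓ) u ≟ᵇ true))
    (λ p≗q (feasible , inf) → feasible-cong λ' p≗q feasible
                            , influenced-cong p≗q (λ' ∸ ℓ) u j≤u u≤k inf)
    B (λ (feasible , _) → feasible-bounded feasible)
    (thresholds-feasible λ' , seed-influenced (λ' ∸ ℓ) refl)

  optimum-chain : ∀ ℓ ℓ' → ℓ ≤ ℓ' →
    Σ ℕ λ a → Σ ℕ λ b → Σ ℕ λ c → Σ ℕ λ d →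
      IsMinCost j k Assisted a × IsMinCost j k Feasible b
      × IsMinCost j k (InfluencedBy ℓ) c × IsMinCost j k (InfluencedBy ℓ') d
      × a ≤ b × b ≤ c × c ≤ d × d ≤ suc a
  optimum-chain ℓ ℓ' ℓ≤ℓ'
    with assisted-optimum | feasible-optimum
       | influencedBy-optimum ℓ | influencedBy-optimum ℓ'
  ... | a , A | b , F | c , C | d , D =
    a , b , c , d , A , F , C , D
    , minCost-≤ {j} {k} 0 A F (λ {p} Fp → _ , drop-assist Fp , sumFrom-update p u 0 j (suc k ∸ j))
    , minCost-⊆ {j} {k} F C proj₁
    , minCost-⊆ {j} {k} C D (InfluencedBy-mono ℓ≤ℓ')
    , minCost-≤ {j} {k} 1 D A (λ {p} Ap → _ , pay-for-assist ℓ' Ap , sumFrom-update p u 1 j (suc k ∸ j))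

lemma2 : (n : ℕ) (t : ℕ → ℕ)
    → t 0 ≡ 1 → t (n ∸ 1) ≡ 1
    → (∀ i → i < n → t i ≡ 1 ⊎ t i ≡ 2)
    → (λ' : ℕ) → 2 ≤ λ'
    → (j k : ℕ) → j ≤ k → k < n
    → (ℓ ℓ' : ℕ) → 1 ≤ ℓ → ℓ < ℓ' → ℓ' ≤ λ'
    → (t k ≡ 1 →
        Σ ℕ λ a → Σ ℕ λ b → Σ ℕ λ c → Σ ℕ λ d →
          IsOPT← t λ' j k a × IsOPT t λ' j k b
          × IsOPT→ t λ' ℓ j k c × IsOPT→ t λ' ℓ' j k d
          × a ≤ b × b ≤ c × c ≤ d × d ≤ suc a)
    × (t j ≡ 1 →
        Σ ℕ λ a → Σ ℕ λ b → Σ ℕ λ c → Σ ℕ λ d →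
          IsOPT→' t λ' j k a × IsOPT t λ' j k b
          × IsOPT←' t λ' ℓ j k c × IsOPT←' t λ' ℓ' j k d
          × a ≤ b × b ≤ c × c ≤ d × d ≤ suc a)
lemma2 _ t _ _ t∈12 λ' _ j k j≤k k<n ℓ ℓ' _ ℓ<ℓ' _ =
    (λ t[k]≡1 → AssistedNode.optimum-chain t λ' j k k j≤k ≤-refl t[k]≡1 t≤2 ℓ ℓ' ℓ≤ℓ')
  , (λ t[j]≡1 → AssistedNode.optimum-chain t λ' j k j ≤-refl j≤k t[j]≡1 t≤2 ℓ ℓ' ℓ≤ℓ')
  where
  ℓ≤ℓ' : ℓ ≤ ℓ'
  ℓ≤ℓ' = <⇒≤ ℓ<ℓ'
  t≤2 : OnPath j k (λ v → t v ≤ 2)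
  t≤2 v _ v≤k = [ (λ t[v]≡1 → ≤-trans (≤-reflexive t[v]≡1) (n≤1+n 1)) , ≤-reflexive ]′
                  (t∈12 v (≤-<-trans v≤k k<n))
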